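{- For every non-deterministic $\lambda$-term $M$, if $M$ is strongly normalizable, then there exist a context $\Gamma$ and a type $A$ such that $\Gamma\vdash M:A$ is derivable in the type system $\mathcal D_+$.
   Context: Non-deterministic $\lambda$-terms are given by $M::=x\mid\lambda x.M\mid (M)N\mid M+N$, taken up to $\alpha$-equivalence and the identities $M+N=N+M$, $(M+N)+P=M+(N+P)$, $\lambda x.(M+N)=\lambda x.M+\lambda x.N$, $(M+N)P=(M)P+(N)P$. $\beta$-reduction is the contextual closure of $(\lambda x.M)N\to_\beta M[N/x]$. The term $M$ is strongly normalizable if it has no infinite $\beta$-reduction sequence. System $\mathcal D_+$. Types are $A,B::=X\mid A\to B\mid A\cap B$, where $X$ ranges over propositional variables. The subtyping relation $\le$ is the least reflexive and transitive relation closed under the rules: - $A_1\cap A_2\le A_i$ for $i=1,2$; - if $A'\le A$ and $B\le B'$ then $A\to B\le A'\to B'$; - $(A\to B)\cap(A\to C)\le A\to(B\cap C)$. Contexts $\Gamma$ assign types to finitely many variables. The typing rules are: - (var) $\Gamma,x:A\vdash x:A$; - (abs) from $\Gamma,x:A\vdash M:B$ infer $\Gamma\vdash\lambda x.M:A\to B$; - (app) from $\Gamma\vdash M:A\to B$ and $\Gamma\vdash N:A$ infer $\Gamma\vdash(M)N:B$; - (int) from $\Gamma\vdash M:A$ and $\Gamma\vdash M:B$ infer $\Gamma\vdash M:A\cap B$; - (plus) from $\Gamma\vdash M:A$ and $\Gamma\vdash N:A$ infer $\Gamma\vdash M+N:A$; - (sub) from $\Gamma\vdash M:A$ and $A\le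 A'$ infer $\Gamma\vdash M:A'$. -}

module Defs where

open import Data.Nat using (ℕ; zero; suc)
open import Data.List using (List; []; _∷_)
open import Data.Product using (Σ; _×_; ∃; _,_)
open import Induction.WellFounded using (Acc)

-- Non-deterministic λ-terms, raw syntax with de Bruijn indices
-- (α-equivalence is thereby built in).

data Tm : Set where
  var  : ℕ → Tm
  lam  : Tm → Tm
  app  : Tm → Tm → Tm      -- app M N  is  (M)N
  plus : Tm → Tm → Tm

ext : (ℕ → ℕ) → ℕ → ℕ
ext ρ zero    = zero
ext ρ (suc n) = suc (ρ n)

rename : (ℕ → ℕ) → Tm → Tm
rename ρ (var n)    = var (ρ n)
rename ρ (lam M)    = lam (rename (ext ρ) M)
rename ρ (app M N)  = app (rename ρ M) (rename ρ N)
rename ρ (plus M N) = plus (rename ρ M) (rename ρ N)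

exts : (ℕ → Tm) → ℕ → Tm
exts σ zero    = var zero
exts σ (suc n) = rename suc (σ n)

subst : (ℕ → Tm) → Tm → Tm
subst σ (var n)    = σ n
subst σ (lam M)    = lam (subst (exts σ) M)
subst σ (app M N)  = app (subst σ M) (subst σ N)
subst σ (plus M N) = plus (subst σ M) (subst σ N)

subst-zero : Tm → ℕ → Tm
subst-zero N zero    = N
subst-zero N (suc n) = var n

-- M [ N ] is M[N/x] where x is the variable bound by the outer λ (index 0).
_[_] : Tm → Tm → Tm
M [ N ] = subst (subst-zero N) M

infix 4 _≅_
data _≅_ : Tm → Tm → Set where
  ≅-refl  : ∀ {M} → M ≅ M
  ≅-sym   : ∀ {M N} → M ≅ N → N ≅ M
  ≅-trans : ∀ {M N P} → M ≅ N → N ≅ P → M ≅ P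
  ≅-lam   : ∀ {M M'} → M ≅ M' → lam M ≅ lam M'
  ≅-app   : ∀ {M M' N N'} → M ≅ M' → N ≅ N' → app M N ≅ app M' N'
  ≅-plus  : ∀ {M M' N N'} → M ≅ M' → N ≅ N' → plus M N ≅ plus M' N'
  ≅-comm  : ∀ {M N} → plus M N ≅ plus N M
  ≅-assoc : ∀ {M N P} → plus (plus M N) P ≅ plus M (plus N P)
  ≅-lamΣ  : ∀ {M N} → lam (plus M N) ≅ plus (lam M) (lam N)
  ≅-appΣ  : ∀ {M N P} → app (plus M N) P ≅ plus (app M P) (app N P)

-- β-reduction: contextual closure of (λx.M)N → M[N/x] on raw terms ...

infix 4 _→β_
data _→β_ : Tm → Tm → Set where
  β      : ∀ {M N} → app (lam M) N →β M [ N ]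
  ξ-lam  : ∀ {M M'} → M →β M' → lam M →β lam M'
  ξ-appˡ : ∀ {M M' N} → M →β M' → app M N →β app M' N
  ξ-appʳ : ∀ {M N N'} → N →β N' → app M N →β app M N'
  ξ-plusˡ : ∀ {M M' N} → M →β M' → plus M N →β plus M' N
  ξ-plusʳ : ∀ {M N N'} → N →β N' → plus M N →β plus M N'

-- ... and on terms up to the identities (equivalence classes):
-- M reduces to N iff some representative of M β-reduces to some
-- representative of N.
infix 4 _⟶_
_⟶_ : Tm → Tm → Set
M ⟶ N = Σ Tm λ M' → Σ Tm λ N' → (M ≅ M') × (M' →β N') × (N' ≅ N)

SN : Tm → Set
SN M = Acc (λ N M' → M' ⟶ N) M

infixr 7 _⇒_
infixl 8 _∩_
data Ty : Set where
  tvar : ℕ → Ty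
  _⇒_  : Ty → Ty → Ty
  _∩_  : Ty → Ty → Ty

infix 4 _≤_
data _≤_ : Ty → Ty → Set where
  ≤-refl  : ∀ {A} → A ≤ A
  ≤-trans : ∀ {A B C} → A ≤ B → B ≤ C → A ≤ C
  ∩-≤ˡ    : ∀ {A₁ A₂} → A₁ ∩ A₂ ≤ A₁
  ∩-≤ʳ    : ∀ {A₁ A₂} → A₁ ∩ A₂ ≤ A₂
  ⇒-≤     : ∀ {A A' B B'} → A' ≤ A → B ≤ B' → A ⇒ B ≤ A' ⇒ B'
  ⇒-∩-≤   : ∀ {A B C} → (A ⇒ B) ∩ (A ⇒ C) ≤ A ⇒ (B ∩ C)

Ctx : Set
Ctx = List Ty

infix 4 _∋_⦂_
data _∋_⦂_ : Ctx → ℕ → Ty → Set where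
  here  : ∀ {Γ A} → (A ∷ Γ) ∋ zero ⦂ A
  there : ∀ {Γ A B n} → Γ ∋ n ⦂ A → (B ∷ Γ) ∋ suc n ⦂ A

-- Typing judgements. Since terms are taken up to ≅, each rule applies to
-- equivalence classes; this is encoded by the rule ⊢-≅ allowing any
-- representative of the class.
infix 4 _⊢_⦂_
data _⊢_⦂_ : Ctx → Tm → Ty → Set where
  ⊢-var  : ∀ {Γ n A} → Γ ∋ n ⦂ A → Γ ⊢ var n ⦂ A
  ⊢-abs  : ∀ {Γ M A B} → (A ∷ Γ) ⊢ M ⦂ B → Γ ⊢ lam M ⦂ A ⇒ B
  ⊢-app  : ∀ {Γ M N A B} → Γ ⊢ M ⦂ A ⇒ B → Γ ⊢ N ⦂ A → Γ ⊢ app M N ⦂ B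
  ⊢-int  : ∀ {Γ M A B} → Γ ⊢ M ⦂ A → Γ ⊢ M ⦂ B → Γ ⊢ M ⦂ A ∩ B
  ⊢-plus : ∀ {Γ M N A} → Γ ⊢ M ⦂ A → Γ ⊢ N ⦂ A → Γ ⊢ plus M N ⦂ A
  ⊢-sub  : ∀ {Γ M A A'} → Γ ⊢ M ⦂ A → A ≤ A' → Γ ⊢ M ⦂ A'
  ⊢-≅    : ∀ {Γ M M' A} → Γ ⊢ M ⦂ A → M ≅ M' → Γ ⊢ M' ⦂ A

-- By induction on the reduction tree of M, and inside it on the size of
-- the subterm at hand, written as a head H applied to arguments E.  If H is
-- a variable, it can be given any type matching the (typable) arguments; an
-- abstraction is typed by its body; a head redex is typed through subject
-- expansion from its contractum; a sum in head position distributes over E.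
-- The difficulty is the rule for +, which needs one type for both summands:
-- every subterm is therefore typed at arrow types S₁ ⇒ … ⇒ S_L ⇒ R of any
-- large enough length L and any target R, and the two summands are brought
-- to a common type by intersecting their argument types componentwise.

module Submission where

open import Defs
open import Data.Product using (Σ; _×_; _,_; proj₁; proj₂)
open import Data.Nat using (ℕ; zero; suc; s≤s; _⊔_; _≟_)
  renaming (_≤_ to _≤ℕ_; _<_ to _<ℕ_; _+_ to _+ℕ_)
open import Data.Nat.Properties
  using (n≤1+n; n<1+n; <-≤-trans; m≤m+n; m≤n+m; +-monoˡ-≤;
         m≤m⊔n; m≤n⊔m; m⊔n≤o⇒m≤o; m⊔n≤o⇒n≤o)
  renaming (≤-refl to ≤ℕ-refl; ≤-trans to ≤ℕ-trans)
open import Data.Nat.Induction using (<-wellFounded)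
open import Data.List using (List; []; _∷_)
open import Data.List.Relation.Unary.All using (All; []; _∷_)
open import Data.List.Relation.Binary.Pointwise using (Pointwise; []; _∷_)
import Data.List.Relation.Binary.Pointwise as Pointwise
open import Data.Vec using (Vec; []; _∷_; _∷ʳ_; zipWith; replicate; fromList)
open import Induction.WellFounded using (Acc; acc)
open import Relation.Nullary using (yes; no; contradiction)
import Relation.Binary.PropositionalEquality as Eq
open Eq using (_≡_; refl; cong)

arrows : ∀ {k} → Vec Ty k → Ty → Ty
arrows []       B = B
arrows (A ∷ As) B = A ⇒ arrows As B

arrows-∷ʳ : ∀ {k} (As : Vec Ty k) A B → arrows (As ∷ʳ A) B ≡ arrows As (A ⇒ B)
arrows-∷ʳ []       A B = refl
arrows-∷ʳ (C ∷ As) A B = cong (C ⇒_) (arrows-∷ʳ As A B)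

arrows-mono-≤ : ∀ {k} (As : Vec Ty k) {B B'} → B ≤ B' → arrows As B ≤ arrows As B'
arrows-mono-≤ []       B≤B' = B≤B'
arrows-mono-≤ (A ∷ As) B≤B' = ⇒-≤ ≤-refl (arrows-mono-≤ As B≤B')

arrows-∩-≤ : ∀ {k} (As : Vec Ty k) {B C} → arrows As B ∩ arrows As C ≤ arrows As (B ∩ C)
arrows-∩-≤ []       = ≤-refl
arrows-∩-≤ (A ∷ As) = ≤-trans ⇒-∩-≤ (⇒-≤ ≤-refl (arrows-∩-≤ As))

arrows-zip-≤ˡ : ∀ {k} (S₁ S₂ : Vec Ty k) R → arrows S₁ R ≤ arrows (zipWith _∩_ S₁ S₂) R
arrows-zip-≤ˡ []       []       R = ≤-refl
arrows-zip-≤ˡ (A ∷ S₁) (B ∷ S₂) R = ⇒-≤ ∩-≤ˡ (arrows-zip-≤ˡ S₁ S₂ R)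

arrows-zip-≤ʳ : ∀ {k} (S₁ S₂ : Vec Ty k) R → arrows S₂ R ≤ arrows (zipWith _∩_ S₁ S₂) R
arrows-zip-≤ʳ []       []       R = ≤-refl
arrows-zip-≤ʳ (A ∷ S₁) (B ∷ S₂) R = ⇒-≤ ∩-≤ʳ (arrows-zip-≤ʳ S₁ S₂ R)

-- ≤ has no rule A ≤ A ∩ A; ⊑ adds ∩-introduction on the right, which is
-- admissible for typing thanks to the rule (int).
infix 4 _⊑_
data _⊑_ : Ty → Ty → Set where
  ≤⇒⊑     : ∀ {A B} → A ≤ B → A ⊑ B
  ⊑-trans : ∀ {A B C} → A ⊑ B → B ⊑ C → A ⊑ C
  ⊑-∩     : ∀ {A B C} → A ⊑ B → A ⊑ C → A ⊑ B ∩ C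
  ⊑-⇒     : ∀ {A A' B B'} → A' ≤ A → B ⊑ B' → A ⇒ B ⊑ A' ⇒ B'

⊑-refl : ∀ {A} → A ⊑ A
⊑-refl = ≤⇒⊑ ≤-refl

⊢-⊑-under-arrows : ∀ {Γ M k} (As : Vec Ty k) {B B'} →
                   Γ ⊢ M ⦂ arrows As B → B ⊑ B' → Γ ⊢ M ⦂ arrows As B'
⊢-⊑-under-arrows As d (≤⇒⊑ B≤B') = ⊢-sub d (arrows-mono-≤ As B≤B')
⊢-⊑-under-arrows As d (⊑-trans p q) = ⊢-⊑-under-arrows As (⊢-⊑-under-arrows As d p) q
⊢-⊑-under-arrows As d (⊑-∩ p q) =
  ⊢-sub (⊢-int (⊢-⊑-under-arrows As d p) (⊢-⊑-under-arrows As d q)) (arrows-∩-≤ As)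
⊢-⊑-under-arrows {Γ} {M} As {A ⇒ B} {A' ⇒ B'} d (⊑-⇒ A'≤A q) =
  ⊢-sub (retype (arrows-∷ʳ As A B') d′) (arrows-mono-≤ As (⇒-≤ A'≤A ≤-refl))
  where
  retype : ∀ {C D} → C ≡ D → Γ ⊢ M ⦂ C → Γ ⊢ M ⦂ D
  retype = Eq.subst (Γ ⊢ M ⦂_)
  d′ : Γ ⊢ M ⦂ arrows (As ∷ʳ A) B'
  d′ = ⊢-⊑-under-arrows (As ∷ʳ A) (retype (Eq.sym (arrows-∷ʳ As A B)) d) q

⊢-⊑ : ∀ {Γ M A B} → Γ ⊢ M ⦂ A → A ⊑ B → Γ ⊢ M ⦂ B
⊢-⊑ = ⊢-⊑-under-arrows []

-- Typing without the rule ⊢-≅, so that derivations can be inverted along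
-- the raw term, over total contexts, so that contexts can be intersected.
FCtx : Set
FCtx = ℕ → Ty

infixr 5 _∷ᶠ_
_∷ᶠ_ : Ty → FCtx → FCtx
(A ∷ᶠ γ) zero    = A
(A ∷ᶠ γ) (suc n) = γ n

infixl 6 _⊓_
_⊓_ : FCtx → FCtx → FCtx
(γ ⊓ δ) n = γ n ∩ δ n

infix 4 _⊩_⦂_
data _⊩_⦂_ : FCtx → Tm → Ty → Set where
  ⊩-var  : ∀ {γ n} → γ ⊩ var n ⦂ γ n
  ⊩-abs  : ∀ {γ M A B} → A ∷ᶠ γ ⊩ M ⦂ B → γ ⊩ lam M ⦂ A ⇒ B
  ⊩-app  : ∀ {γ M N A B} → γ ⊩ M ⦂ A ⇒ B → γ ⊩ N ⦂ A → γ ⊩ app M N ⦂ B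
  ⊩-int  : ∀ {γ M A B} → γ ⊩ M ⦂ A → γ ⊩ M ⦂ B → γ ⊩ M ⦂ A ∩ B
  ⊩-plus : ∀ {γ M N A} → γ ⊩ M ⦂ A → γ ⊩ N ⦂ A → γ ⊩ plus M N ⦂ A
  ⊩-sub  : ∀ {γ M A B} → γ ⊩ M ⦂ A → A ⊑ B → γ ⊩ M ⦂ B

data Scoped : ℕ → Tm → Set where
  var  : ∀ {k n} → n <ℕ k → Scoped k (var n)
  lam  : ∀ {k M} → Scoped (suc k) M → Scoped k (lam M)
  app  : ∀ {k M N} → Scoped k M → Scoped k N → Scoped k (app M N)
  plus : ∀ {k M N} → Scoped k M → Scoped k N → Scoped k (plus M N)

Scoped-mono : ∀ {k k' M} → k ≤ℕ k' → Scoped k M → Scoped k' M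
Scoped-mono k≤k' (var n<k)  = var (<-≤-trans n<k k≤k')
Scoped-mono k≤k' (lam s)    = lam (Scoped-mono (s≤s k≤k') s)
Scoped-mono k≤k' (app s t)  = app (Scoped-mono k≤k' s) (Scoped-mono k≤k' t)
Scoped-mono k≤k' (plus s t) = plus (Scoped-mono k≤k' s) (Scoped-mono k≤k' t)

scoped : ∀ M → Σ ℕ λ k → Scoped k M
scoped (var n) = suc n , var ≤ℕ-refl
scoped (lam M) = let (k , s) = scoped M in k , lam (Scoped-mono (n≤1+n k) s)
scoped (app M N) =
  let (k , s) = scoped M ; (j , t) = scoped N in
  k ⊔ j , app (Scoped-mono (m≤m⊔n k j) s) (Scoped-mono (m≤n⊔m k j) t)
scoped (plus M N) =
  let (k , s) = scoped M ; (j , t) = scoped N in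
  k ⊔ j , plus (Scoped-mono (m≤m⊔n k j) s) (Scoped-mono (m≤n⊔m k j) t)

prefix : ℕ → FCtx → Ctx
prefix zero    γ = []
prefix (suc k) γ = γ zero ∷ prefix k (λ n → γ (suc n))

prefix-∋ : ∀ {k n} γ → n <ℕ k → prefix k γ ∋ n ⦂ γ n
prefix-∋ {suc k} {zero}  γ n<k       = here
prefix-∋ {suc k} {suc n} γ (s≤s n<k) = there (prefix-∋ (λ m → γ (suc m)) n<k)

⊩⇒⊢ : ∀ {k γ M A} → γ ⊩ M ⦂ A → Scoped k M → prefix k γ ⊢ M ⦂ A
⊩⇒⊢ {γ = γ} ⊩-var (var n<k) = ⊢-var (prefix-∋ γ n<k)
⊩⇒⊢ (⊩-abs d)    (lam s)    = ⊢-abs (⊩⇒⊢ d s)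
⊩⇒⊢ (⊩-app d e)  (app s t)  = ⊢-app (⊩⇒⊢ d s) (⊩⇒⊢ e t)
⊩⇒⊢ (⊩-int d e)  s          = ⊢-int (⊩⇒⊢ d s) (⊩⇒⊢ e s)
⊩⇒⊢ (⊩-plus d e) (plus s t) = ⊢-plus (⊩⇒⊢ d s) (⊩⇒⊢ e t)
⊩⇒⊢ (⊩-sub d p)  s          = ⊢-⊑ (⊩⇒⊢ d s) p

infix 4 _⊑ᶜ_
_⊑ᶜ_ : FCtx → FCtx → Set
δ ⊑ᶜ γ = ∀ n → δ n ⊑ γ n

∷ᶠ-⊑ᶜ : ∀ {δ γ} A → δ ⊑ᶜ γ → A ∷ᶠ δ ⊑ᶜ A ∷ᶠ γ
∷ᶠ-⊑ᶜ A δ⊑γ zero    = ⊑-refl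
∷ᶠ-⊑ᶜ A δ⊑γ (suc n) = δ⊑γ n

⊓-⊑ᶜˡ : ∀ γ δ → γ ⊓ δ ⊑ᶜ γ
⊓-⊑ᶜˡ γ δ n = ≤⇒⊑ ∩-≤ˡ

⊓-⊑ᶜʳ : ∀ γ δ → γ ⊓ δ ⊑ᶜ δ
⊓-⊑ᶜʳ γ δ n = ≤⇒⊑ ∩-≤ʳ

⊩-narrow : ∀ {δ γ M A} → δ ⊑ᶜ γ → γ ⊩ M ⦂ A → δ ⊩ M ⦂ A
⊩-narrow δ⊑γ (⊩-var {n = n})  = ⊩-sub ⊩-var (δ⊑γ n)
⊩-narrow δ⊑γ (⊩-abs {A = A} d) = ⊩-abs (⊩-narrow (∷ᶠ-⊑ᶜ A δ⊑γ) d)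
⊩-narrow δ⊑γ (⊩-app d e)      = ⊩-app (⊩-narrow δ⊑γ d) (⊩-narrow δ⊑γ e)
⊩-narrow δ⊑γ (⊩-int d e)      = ⊩-int (⊩-narrow δ⊑γ d) (⊩-narrow δ⊑γ e)
⊩-narrow δ⊑γ (⊩-plus d e)     = ⊩-plus (⊩-narrow δ⊑γ d) (⊩-narrow δ⊑γ e)
⊩-narrow δ⊑γ (⊩-sub d p)      = ⊩-sub (⊩-narrow δ⊑γ d) p

⊩-rename : ∀ {γ δ M A} ρ → (∀ n → δ (ρ n) ⊑ γ n) → γ ⊩ M ⦂ A → δ ⊩ rename ρ M ⦂ A
⊩-rename ρ h (⊩-var {n = n})  = ⊩-sub ⊩-var (h n)
⊩-rename {γ} {δ} ρ h (⊩-abs {A = A} d) = ⊩-abs (⊩-rename (ext ρ) h′ d)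
  where
  h′ : ∀ n → (A ∷ᶠ δ) (ext ρ n) ⊑ (A ∷ᶠ γ) n
  h′ zero    = ⊑-refl
  h′ (suc n) = h n
⊩-rename ρ h (⊩-app d e)  = ⊩-app (⊩-rename ρ h d) (⊩-rename ρ h e)
⊩-rename ρ h (⊩-int d e)  = ⊩-int (⊩-rename ρ h d) (⊩-rename ρ h e)
⊩-rename ρ h (⊩-plus d e) = ⊩-plus (⊩-rename ρ h d) (⊩-rename ρ h e)
⊩-rename ρ h (⊩-sub d p)  = ⊩-sub (⊩-rename ρ h d) p

⊩-var-inv : ∀ {γ n A} → γ ⊩ var n ⦂ A → γ n ⊑ A
⊩-var-inv ⊩-var       = ⊑-refl
⊩-var-inv (⊩-int d e) = ⊑-∩ (⊩-var-inv d) (⊩-var-inv e)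
⊩-var-inv (⊩-sub d p) = ⊑-trans (⊩-var-inv d) p

⊩-app-inv : ∀ {γ M N A} → γ ⊩ app M N ⦂ A → Σ Ty λ C → γ ⊩ M ⦂ C ⇒ A × γ ⊩ N ⦂ C
⊩-app-inv (⊩-app d e) = _ , d , e
⊩-app-inv (⊩-int d e) =
  let (C₁ , d₁ , e₁) = ⊩-app-inv d ; (C₂ , d₂ , e₂) = ⊩-app-inv e in
  C₁ ∩ C₂ ,
  ⊩-sub (⊩-int (⊩-sub d₁ (⊑-⇒ ∩-≤ˡ ⊑-refl)) (⊩-sub d₂ (⊑-⇒ ∩-≤ʳ ⊑-refl))) (≤⇒⊑ ⇒-∩-≤) ,
  ⊩-int e₁ e₂
⊩-app-inv (⊩-sub d p) = let (C , d₁ , e₁) = ⊩-app-inv d in C , ⊩-sub d₁ (⊑-⇒ ≤-refl p) , e₁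

⊩-plus-inv : ∀ {γ M N A} → γ ⊩ plus M N ⦂ A → γ ⊩ M ⦂ A × γ ⊩ N ⦂ A
⊩-plus-inv (⊩-plus d e) = d , e
⊩-plus-inv (⊩-int d e)  =
  let (d₁ , e₁) = ⊩-plus-inv d ; (d₂ , e₂) = ⊩-plus-inv e in ⊩-int d₁ d₂ , ⊩-int e₁ e₂
⊩-plus-inv (⊩-sub d p)  = let (d₁ , e₁) = ⊩-plus-inv d in ⊩-sub d₁ p , ⊩-sub e₁ p

⊩-unrename : ∀ {δ A} ρ M → δ ⊩ rename ρ M ⦂ A → (λ n → δ (ρ n)) ⊩ M ⦂ A
⊩-unrename ρ (var n) d = ⊩-sub ⊩-var (⊩-var-inv d)
⊩-unrename ρ (lam M) (⊩-abs d) = ⊩-abs (⊩-narrow lemma (⊩-unrename (ext ρ) M d))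
  where
  lemma : ∀ {δ B} → B ∷ᶠ (λ n → δ (ρ n)) ⊑ᶜ (λ n → (B ∷ᶠ δ) (ext ρ n))
  lemma zero    = ⊑-refl
  lemma (suc n) = ⊑-refl
⊩-unrename ρ (lam M) (⊩-int d e) = ⊩-int (⊩-unrename ρ (lam M) d) (⊩-unrename ρ (lam M) e)
⊩-unrename ρ (lam M) (⊩-sub d p) = ⊩-sub (⊩-unrename ρ (lam M) d) p
⊩-unrename ρ (app M N) d =
  let (C , d₁ , e₁) = ⊩-app-inv d in ⊩-app (⊩-unrename ρ M d₁) (⊩-unrename ρ N e₁)
⊩-unrename ρ (plus M N) d =
  let (d₁ , e₁) = ⊩-plus-inv d in ⊩-plus (⊩-unrename ρ M d₁) (⊩-unrename ρ N e₁)

update : FCtx → ℕ → Ty → FCtx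
update γ m A n with n ≟ m
... | yes _ = A
... | no  _ = γ n

update-≡ : ∀ γ m A → update γ m A m ≡ A
update-≡ γ m A with m ≟ m
... | yes _   = refl
... | no  m≢m = contradiction refl m≢m

update-pointwise : (P : ℕ → Ty → Set) {γ : FCtx} {m : ℕ} {A : Ty} →
                   (∀ n → P n (γ n)) → P m A → ∀ n → P n (update γ m A n)
update-pointwise P {m = m} h a n with n ≟ m
... | yes refl = a
... | no  _    = h n

infix 4 _⊩ˢ_⦂_
_⊩ˢ_⦂_ : FCtx → (ℕ → Tm) → FCtx → Set
γ ⊩ˢ σ ⦂ δ = ∀ n → γ ⊩ σ n ⦂ δ n

⊓-⊩ˢ : ∀ {γ σ δ₁ δ₂} → γ ⊩ˢ σ ⦂ δ₁ → γ ⊩ˢ σ ⦂ δ₂ → γ ⊩ˢ σ ⦂ δ₁ ⊓ δ₂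
⊓-⊩ˢ h₁ h₂ n = ⊩-int (h₁ n) (h₂ n)

-- Every typing of subst σ M factors through a typing of M whose context
-- is realised by σ; the typability of each σ n supplies the context entries
-- of variables not occurring in M.
⊩-antisubst : ∀ {γ A} σ M → γ ⊩ subst σ M ⦂ A → (∀ n → Σ Ty (γ ⊩ σ n ⦂_)) →
              Σ FCtx λ δ → δ ⊩ M ⦂ A × γ ⊩ˢ σ ⦂ δ
⊩-antisubst {γ} {A} σ (var m) d σ-typable =
  update τ m A ,
  Eq.subst (update τ m A ⊩ var m ⦂_) (update-≡ τ m A) ⊩-var ,
  update-pointwise (λ n C → γ ⊩ σ n ⦂ C) (λ n → proj₂ (σ-typable n)) d
  where
  τ : FCtx
  τ n = proj₁ (σ-typable n)
⊩-antisubst {γ} σ (lam M) (⊩-abs {A = B} d) σ-typable =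
  let (δ , e , h) = ⊩-antisubst (exts σ) M d exts-typable in
  (λ n → δ (suc n)) ,
  ⊩-abs (⊩-narrow (head-⊑ δ h) e) ,
  (λ n → ⊩-unrename suc (σ n) (h (suc n)))
  where
  exts-typable : ∀ n → Σ Ty (B ∷ᶠ γ ⊩ exts σ n ⦂_)
  exts-typable zero    = B , ⊩-var
  exts-typable (suc n) =
    proj₁ (σ-typable n) , ⊩-rename suc (λ _ → ⊑-refl) (proj₂ (σ-typable n))
  head-⊑ : ∀ δ → B ∷ᶠ γ ⊩ˢ exts σ ⦂ δ → B ∷ᶠ (λ n → δ (suc n)) ⊑ᶜ δ
  head-⊑ δ h zero    = ⊩-var-inv (h zero)
  head-⊑ δ h (suc n) = ⊑-refl
⊩-antisubst σ (lam M) (⊩-int d e) σ-typable =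
  let (δ₁ , d₁ , h₁) = ⊩-antisubst σ (lam M) d σ-typable
      (δ₂ , d₂ , h₂) = ⊩-antisubst σ (lam M) e σ-typable in
  δ₁ ⊓ δ₂ , ⊩-int (⊩-narrow (⊓-⊑ᶜˡ δ₁ δ₂) d₁) (⊩-narrow (⊓-⊑ᶜʳ δ₁ δ₂) d₂) , ⊓-⊩ˢ h₁ h₂
⊩-antisubst σ (lam M) (⊩-sub d p) σ-typable =
  let (δ , e , h) = ⊩-antisubst σ (lam M) d σ-typable in δ , ⊩-sub e p , h
⊩-antisubst σ (app M N) d σ-typable =
  let (C , d₁ , e₁) = ⊩-app-inv d
      (δ₁ , d₂ , h₁) = ⊩-antisubst σ M d₁ σ-typable
      (δ₂ , e₂ , h₂) = ⊩-antisubst σ N e₁ σ-typable in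
  δ₁ ⊓ δ₂ , ⊩-app (⊩-narrow (⊓-⊑ᶜˡ δ₁ δ₂) d₂) (⊩-narrow (⊓-⊑ᶜʳ δ₁ δ₂) e₂) , ⊓-⊩ˢ h₁ h₂
⊩-antisubst σ (plus M N) d σ-typable =
  let (d₁ , e₁) = ⊩-plus-inv d
      (δ₁ , d₂ , h₁) = ⊩-antisubst σ M d₁ σ-typable
      (δ₂ , e₂ , h₂) = ⊩-antisubst σ N e₁ σ-typable in
  δ₁ ⊓ δ₂ , ⊩-plus (⊩-narrow (⊓-⊑ᶜˡ δ₁ δ₂) d₂) (⊩-narrow (⊓-⊑ᶜʳ δ₁ δ₂) e₂) , ⊓-⊩ˢ h₁ h₂

-- The argument N must be typable since P may discard it.
⊩-β-expand : ∀ {θ P N A B} → θ ⊩ N ⦂ B → θ ⊩ P [ N ] ⦂ A → θ ⊩ app (lam P) N ⦂ A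
⊩-β-expand {θ} {P} {N} {B = B} dN d =
  let (δ , e , h) = ⊩-antisubst (subst-zero N) P d typable in
  ⊩-app (⊩-abs (⊩-narrow (tail-⊑ δ h) e)) (h zero)
  where
  typable : ∀ n → Σ Ty (θ ⊩ subst-zero N n ⦂_)
  typable zero    = B , dN
  typable (suc n) = θ n , ⊩-var
  tail-⊑ : ∀ δ → θ ⊩ˢ subst-zero N ⦂ δ → δ zero ∷ᶠ θ ⊑ᶜ δ
  tail-⊑ δ h zero    = ⊑-refl
  tail-⊑ δ h (suc n) = ⊩-var-inv (h (suc n))

spine : Tm → List Tm → Tm
spine X []      = X
spine X (N ∷ E) = spine (app X N) E

size : Tm → ℕ
size (var _)    = 1
size (lam M)    = suc (size M)
size (app M N)  = suc (size M +ℕ size N)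
size (plus M N) = suc (size M +ℕ size N)

size-spine-≥ : ∀ E X → size X ≤ℕ size (spine X E)
size-spine-≥ []      X = ≤ℕ-refl
size-spine-≥ (N ∷ E) X =
  ≤ℕ-trans (≤ℕ-trans (m≤m+n (size X) (size N)) (n≤1+n _)) (size-spine-≥ E (app X N))

size-spine-arg : ∀ E X N → size N <ℕ size (spine X (N ∷ E))
size-spine-arg E X N = <-≤-trans (s≤s (m≤n+m (size N) (size X))) (size-spine-≥ E (app X N))

size-spine-mono-< : ∀ E {X Y} → size X <ℕ size Y → size (spine X E) <ℕ size (spine Y E)
size-spine-mono-< []      X<Y = X<Y
size-spine-mono-< (N ∷ E) X<Y = size-spine-mono-< E (s≤s (+-monoˡ-≤ (size N) X<Y))

spine-→β : ∀ E {X Y} → X →β Y → spine X E →β spine Y E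
spine-→β []      r = r
spine-→β (N ∷ E) r = spine-→β E (ξ-appˡ r)

spine-≅ : ∀ E {X Y} → X ≅ Y → spine X E ≅ spine Y E
spine-≅ []      p = p
spine-≅ (N ∷ E) p = spine-≅ E (≅-app p ≅-refl)

spine-plus-≅ : ∀ E {X Y} → spine (plus X Y) E ≅ plus (spine X E) (spine Y E)
spine-plus-≅ []      = ≅-refl
spine-plus-≅ (N ∷ E) = ≅-trans (spine-≅ E ≅-appΣ) (spine-plus-≅ E)

record Frame : Set where
  field
    plug    : Tm → Tm
    plug-→β : ∀ {X Y} → X →β Y → plug X →β plug Y
    plug-≅  : ∀ {X Y} → X ≅ Y → plug X ≅ plug Y

open Frame

id-frame : Frame
id-frame = record { plug = λ X → X ; plug-→β = λ r → r ; plug-≅ = λ p → p }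

infixr 9 _∘ᶠ_
_∘ᶠ_ : Frame → Frame → Frame
K ∘ᶠ K′ = record
  { plug    = λ X → plug K (plug K′ X)
  ; plug-→β = λ r → plug-→β K (plug-→β K′ r)
  ; plug-≅  = λ p → plug-≅ K (plug-≅ K′ p)
  }

lam-frame : Frame
lam-frame = record { plug = lam ; plug-→β = ξ-lam ; plug-≅ = ≅-lam }

appʳ-frame : Tm → Frame
appʳ-frame M = record
  { plug = app M ; plug-→β = ξ-appʳ ; plug-≅ = λ p → ≅-app ≅-refl p }

plusˡ-frame : Tm → Frame
plusˡ-frame N = record
  { plug = λ X → plus X N ; plug-→β = ξ-plusˡ ; plug-≅ = λ p → ≅-plus p ≅-refl }

plusʳ-frame : Tm → Frame
plusʳ-frame M = record
  { plug = plus M ; plug-→β = ξ-plusʳ ; plug-≅ = λ p → ≅-plus ≅-refl p }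

spine-frame : List Tm → Frame
spine-frame E = record { plug = λ X → spine X E ; plug-→β = spine-→β E ; plug-≅ = spine-≅ E }

infix 4 _occurs-in_
_occurs-in_ : Tm → Tm → Set
X occurs-in T = Σ Frame λ K → T ≅ plug K X

occurs-in-refl : ∀ {T} → T occurs-in T
occurs-in-refl = id-frame , ≅-refl

occurs-in-plug : ∀ {X T} K → plug K X occurs-in T → X occurs-in T
occurs-in-plug K′ (K , T≅KX) = K ∘ᶠ K′ , T≅KX

occurs-in-≅ : ∀ {X Y T} → X occurs-in T → X ≅ Y → Y occurs-in T
occurs-in-≅ (K , T≅KX) X≅Y = K , ≅-trans T≅KX (plug-≅ K X≅Y)

occurs-in-→β : ∀ {X Y T} → X occurs-in T → X →β Y → Σ Tm λ T′ → T ⟶ T′ × Y occurs-in T′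
occurs-in-→β {X} {Y} (K , T≅KX) r =
  plug K Y , (plug K X , plug K Y , T≅KX , plug-→β K r , ≅-refl) , (K , ≅-refl)

Typable : Tm → Set
Typable X = Σ FCtx λ γ → Σ Ty (γ ⊩ X ⦂_)

Flexible : Tm → Set
Flexible X = Σ ℕ λ n → ∀ {L} → n ≤ℕ L → ∀ R →
             Σ FCtx λ γ → Σ (Vec Ty L) λ S → γ ⊩ X ⦂ arrows S R

Flexible⇒Typable : ∀ {X} → Flexible X → Typable X
Flexible⇒Typable (n , typing) =
  let (γ , S , d) = typing ≤ℕ-refl (tvar 0) in γ , arrows S (tvar 0) , d

Flexible-map : ∀ {X Y} → (∀ {γ A} → γ ⊩ X ⦂ A → γ ⊩ Y ⦂ A) → Flexible X → Flexible Y
Flexible-map f (n , typing) =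
  n , λ n≤L R → let (γ , S , d) = typing n≤L R in γ , S , f d

lam-flexible : ∀ {P} → Flexible P → Flexible (lam P)
lam-flexible (n , typing) = suc n , λ { (s≤s n≤L) R →
  let (γ , S , d) = typing n≤L R in
  (λ m → γ (suc m)) , γ zero ∷ S , ⊩-abs (⊩-narrow head-tail d) }
  where
  head-tail : ∀ {γ} → γ zero ∷ᶠ (λ m → γ (suc m)) ⊑ᶜ γ
  head-tail zero    = ⊑-refl
  head-tail (suc m) = ⊑-refl

plus-flexible : ∀ {X Y} → Flexible X → Flexible Y → Flexible (plus X Y)
plus-flexible (n₁ , typing₁) (n₂ , typing₂) = n₁ ⊔ n₂ , λ n≤L R →
  let (γ₁ , S₁ , d₁) = typing₁ (m⊔n≤o⇒m≤o n₁ n₂ n≤L) R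
      (γ₂ , S₂ , d₂) = typing₂ (m⊔n≤o⇒n≤o n₁ n₂ n≤L) R in
  γ₁ ⊓ γ₂ , zipWith _∩_ S₁ S₂ ,
  ⊩-plus (⊩-sub (⊩-narrow (⊓-⊑ᶜˡ γ₁ γ₂) d₁) (≤⇒⊑ (arrows-zip-≤ˡ S₁ S₂ R)))
         (⊩-sub (⊩-narrow (⊓-⊑ᶜʳ γ₁ γ₂) d₂) (≤⇒⊑ (arrows-zip-≤ʳ S₁ S₂ R)))

⊩-spine : ∀ {θ H E Cs T} →
          θ ⊩ H ⦂ arrows (fromList Cs) T → Pointwise (_⊩_⦂_ θ) E Cs → θ ⊩ spine H E ⦂ T
⊩-spine d []       = d
⊩-spine d (e ∷ es) = ⊩-spine (⊩-app d e) es

All-Typable⇒common : ∀ {E} → All Typable E →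
                     Σ FCtx λ γ → Σ (List Ty) λ Cs → Pointwise (_⊩_⦂_ γ) E Cs
All-Typable⇒common [] = (λ _ → tvar 0) , [] , []
All-Typable⇒common ((δ , C , d) ∷ typables) =
  let (γ , Cs , ds) = All-Typable⇒common typables in
  δ ⊓ γ , C ∷ Cs , ⊩-narrow (⊓-⊑ᶜˡ δ γ) d ∷ Pointwise.map (⊩-narrow (⊓-⊑ᶜʳ δ γ)) ds

var-flexible : ∀ x E → All Typable E → Flexible (spine (var x) E)
var-flexible x E typables = 0 , λ {L} _ R →
  let (γ , Cs , ds) = All-Typable⇒common typables
      S = replicate L (tvar 0)
      xType = arrows (fromList Cs) (arrows S R)
      θ = γ ⊓ update (λ _ → tvar 0) x xType
      dx = Eq.subst (θ ⊩ var x ⦂_) (update-≡ _ x xType) (⊩-sub ⊩-var (≤⇒⊑ ∩-≤ʳ)) in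
  θ , S , ⊩-spine dx (Pointwise.map (⊩-narrow (⊓-⊑ᶜˡ γ _)) ds)

Inherits : FCtx → Tm → Tm → Tm → Set
Inherits θ X₁ X₂ Y = ∀ {A} → θ ⊩ X₁ ⦂ A → θ ⊩ X₂ ⦂ A → θ ⊩ Y ⦂ A

spine-Inherits : ∀ {θ} E {X₁ X₂ Y} → Inherits θ X₁ X₂ Y →
                 Inherits θ (spine X₁ E) (spine X₂ E) (spine Y E)
spine-Inherits []      inh = inh
spine-Inherits (N ∷ E) inh = spine-Inherits E λ d₁ d₂ →
  let (C₁ , f₁ , a₁) = ⊩-app-inv d₁ ; (C₂ , f₂ , a₂) = ⊩-app-inv d₂ in
  ⊩-app (inh (⊩-sub f₁ (⊑-⇒ ∩-≤ˡ ⊑-refl)) (⊩-sub f₂ (⊑-⇒ ∩-≤ʳ ⊑-refl))) (⊩-int a₁ a₂)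

spine-plus-flexible : ∀ M₁ M₂ E → Flexible (plus (spine M₁ E) (spine M₂ E)) →
                      Flexible (spine (plus M₁ M₂) E)
spine-plus-flexible M₁ M₂ E = Flexible-map λ d →
  let (d₁ , d₂) = ⊩-plus-inv d in spine-Inherits E ⊩-plus d₁ d₂

redex-flexible : ∀ P N E → Flexible (spine (P [ N ]) E) → Typable N →
                 Flexible (spine (app (lam P) N) E)
redex-flexible P N E (n , typing) (δ , B , dN) = n , λ n≤L R →
  let (γ , S , d) = typing n≤L R
      dN′ = ⊩-narrow (⊓-⊑ᶜʳ γ δ) dN
      d′  = ⊩-narrow (⊓-⊑ᶜˡ γ δ) d in
  γ ⊓ δ , S , spine-Inherits E (λ e _ → ⊩-β-expand dN′ e) d′ d′

arguments-typable : ∀ {T} H E → spine H E occurs-in T →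
                    (∀ {N} → N occurs-in T → size N <ℕ size (spine H E) → Typable N) →
                    All Typable E
arguments-typable H []      occ typable = []
arguments-typable H (N ∷ E) occ typable =
  typable (occurs-in-plug (spine-frame E ∘ᶠ appʳ-frame H) occ) (size-spine-arg E H N)
  ∷ arguments-typable (app H N) E occ typable

-- The strong normalisation of the whole term T is carried along, since
-- contracting a redex inside an occurrence is a reduction step of T.
occurrence-flexible : ∀ {T} → SN T → ∀ M E → spine M E occurs-in T →
                      Acc _<ℕ_ (size (spine M E)) → Flexible (spine M E)
occurrence-flexible sn (var x) E occ (acc smaller) =
  var-flexible x E (arguments-typable (var x) E occ λ {N} occN N< →
    Flexible⇒Typable (occurrence-flexible sn N [] occN (smaller N<)))
occurrence-flexible sn (lam P) [] occ (acc smaller) =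
  lam-flexible
    (occurrence-flexible sn P [] (occurs-in-plug lam-frame occ) (smaller (n<1+n (size P))))
occurrence-flexible (acc reducts) (lam P) (N ∷ E) occ (acc smaller) =
  let (T′ , T⟶T′ , occ′) = occurs-in-→β occ (spine-→β E β) in
  redex-flexible P N E
    (occurrence-flexible (reducts T⟶T′) (P [ N ]) E occ′ (<-wellFounded _))
    (Flexible⇒Typable (occurrence-flexible (acc reducts) N []
      (occurs-in-plug (spine-frame E ∘ᶠ appʳ-frame (lam P)) occ)
      (smaller (size-spine-arg E (lam P) N))))
occurrence-flexible sn (app M₁ M₂) E occ size-acc =
  occurrence-flexible sn M₁ (M₂ ∷ E) occ size-acc
occurrence-flexible sn (plus M₁ M₂) E occ (acc smaller) =
  spine-plus-flexible M₁ M₂ E (plus-flexible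
    (occurrence-flexible sn (spine M₁ E) [] (occurs-in-plug (plusˡ-frame (spine M₂ E)) occ+)
      (smaller (size-spine-mono-< E (s≤s (m≤m+n (size M₁) (size M₂))))))
    (occurrence-flexible sn (spine M₂ E) [] (occurs-in-plug (plusʳ-frame (spine M₁ E)) occ+)
      (smaller (size-spine-mono-< E (s≤s (m≤n+m (size M₂) (size M₁)))))))
  where
  occ+ : plus (spine M₁ E) (spine M₂ E) occurs-in _
  occ+ = occurs-in-≅ occ (spine-plus-≅ E)

theorem3 : (M : Tm) → SN M → Σ Ctx (λ Γ → Σ Ty (λ A → Γ ⊢ M ⦂ A))
theorem3 M sn =
  let flexible = occurrence-flexible sn M [] occurs-in-refl (<-wellFounded _)
      (γ , A , d) = Flexible⇒Typable flexible
      (k , s) = scoped M in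
  prefix k γ , A , ⊩⇒⊢ d s
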